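{- Let $0<q<1$ and $\beta_0,\beta_1,\dots\in\mathbb{R}$ with $\beta_0\ne0$. Define $\alpha_0=1/\beta_0$ and, for $j\ge1$, $\alpha_j=\frac{(-1)^j}{\beta_0^{j+1}}\det H_j$, where $H_j$ is the $j\times j$ matrix with rows and columns indexed by $r,c\in\{1,\dots,j\}$ and entry $\left[\begin{smallmatrix} c\\ r-1\end{smallmatrix}\right]_q\beta_{c-r+1}$ if $c\ge r-1$ and $0$ otherwise. Then for every $j\ge1$, \[ \alpha_j=-\frac{1}{\beta_0}\sum_{i=0}^{j-1}\left[\begin{smallmatrix} j\\ i\end{smallmatrix}\right]_q\beta_{j-i}\,\alpha_i . \]
   Context: $[n]_q=\frac{1-q^n}{1-q}$, $[n]_q!=[1]_q\cdots[n]_q$ with $[0]_q!=1$, and $\left[\begin{smallmatrix} n\\ k\end{smallmatrix}\right]_q=\frac{[n]_q!}{[k]_q![n-k]_q!}$. (The numbers $\alpha_j$ are the coefficients in $P_{n,q}(x)=\sum_{j}\left[\begin{smallmatrix} n\\ j\end{smallmatrix}\right]_q\alpha_{n-j}x^j$ for the determinantal polynomials $P_{n,q}$ built from the $\beta_i$.) -}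

module Defs where

open import Level using (Level)
open import Data.Nat using (ℕ; zero; suc; _∸_; _≤?_)
open import Data.Fin using (Fin; toℕ; punchIn) renaming (zero to fzero; suc to fsuc)
open import Relation.Nullary using (yes; no)
open import Algebra.Bundles using (CommutativeRing)

module QDefs {c ℓ : Level} (R : CommutativeRing c ℓ) where
  open CommutativeRing R

  pow : Carrier → ℕ → Carrier
  pow x zero    = 1#
  pow x (suc n) = pow x n * x

  sgn : ℕ → Carrier
  sgn n = pow (- 1#) n

  sumTo : ℕ → (ℕ → Carrier) → Carrier
  sumTo zero    f = 0#
  sumTo (suc n) f = sumTo n f + f n

  sumFin : (n : ℕ) → (Fin n → Carrier) → Carrier
  sumFin zero    f = 0#
  sumFin (suc n) f = f fzero + sumFin n (λ i → f (fsuc i))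

  det : (n : ℕ) → (Fin n → Fin n → Carrier) → Carrier
  det zero    M = 1#
  det (suc n) M =
    sumFin (suc n) (λ k → sgn (toℕ k) * (M fzero k * det n (λ i j → M (fsuc i) (punchIn k j))))

  -- q-analogues, parametrised by q and a given inverse inv1q of (1 - q)
  -- and a given family of inverses fi n of [n]_q!.
  module QNumbers (q inv1q : Carrier) where
    qint : ℕ → Carrier
    qint n = (1# - pow q n) * inv1q

    qfact : ℕ → Carrier
    qfact zero    = 1#
    qfact (suc n) = qfact n * qint (suc n)

    -- [n choose k]_q = [n]_q! / ([k]_q! [n-k]_q!)   (used only for k ≤ n)
    qbinom : (fi : ℕ → Carrier) → ℕ → ℕ → Carrier
    qbinom fi n k = qfact n * (fi k * fi (n ∸ k))

    -- the matrix H_j (0-based indices i,k ↔ r = i+1, c = k+1):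
    -- entry [c choose r-1]_q β_{c-r+1} if c ≥ r-1, else 0
    H : (fi : ℕ → Carrier) (β : ℕ → Carrier) (j : ℕ) → Fin j → Fin j → Carrier
    H fi β j i k with toℕ i ≤? suc (toℕ k)
    ... | yes _ = qbinom fi (suc (toℕ k)) (toℕ i) * β (suc (toℕ k) ∸ toℕ i)
    ... | no  _ = 0#

    alpha : (fi : ℕ → Carrier) (β : ℕ → Carrier) (b0i : Carrier) → ℕ → Carrier
    alpha fi β b0i zero    = b0i
    alpha fi β b0i (suc j) = sgn (suc j) * (pow b0i (suc (suc j)) * det (suc j) (H fi β (suc j)))

-- Expanding det H_j along its first row, the minor obtained by deleting column k is block lower
-- triangular: k diagonal entries β₀, followed by a matrix of the same shape as H with all
-- q-binomial indices shifted by k + 1. So one works with the family G s of shifted matrices.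
-- Normalised by [s]!/[s+m]!, their m×m determinants Δ s m satisfy a recurrence in m whose
-- coefficients do not depend on s; hence Δ s m = Δ 0 m, which turns the first-row expansion into a
-- convolution recurrence for det H_j, and rescaling by (-1)^j β₀^{-(j+1)} gives the one for α_j.
module Submission where

open import Defs
open import Level using (Level)
open import Data.Nat using (ℕ; zero; suc; _∸_; _≤_; _<_; _≤?_; z≤n; s≤s) renaming (_+_ to _+ℕ_)
import Data.Nat.Properties as ℕ
open import Data.Nat.Induction using (<-rec)
open import Data.Fin using (Fin; toℕ; punchIn) renaming (zero to fzero; suc to fsuc)
open import Data.Product using (_,_)
open import Data.Empty using (⊥-elim)
open import Relation.Nullary using (yes; no; ¬_)
open import Relation.Binary.PropositionalEquality as ≡ using (_≡_)
open import Algebra.Bundles using (CommutativeRing)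
open import Algebra.Properties.Ring using (-1*x≈-x; -‿involutive)

module _ {c ℓ : Level} (R : CommutativeRing c ℓ) where
  open CommutativeRing R hiding (zero)
  open QDefs R
  open import Relation.Binary.Reasoning.Setoid setoid
  open import Algebra.Solver.Ring.NaturalCoefficients.Default commutativeSemiring

  *-unitˡ : ∀ {u x} → u ≈ 1# → u * x ≈ x
  *-unitˡ u≈1 = trans (*-cong u≈1 refl) (*-identityˡ _)

  *-absorbsˡ : ∀ {x y} → x ≈ 0# → x * y ≈ 0#
  *-absorbsˡ x≈0 = trans (*-cong x≈0 refl) (zeroˡ _)

  *-absorbsʳ : ∀ {x y} → y ≈ 0# → x * y ≈ 0#
  *-absorbsʳ y≈0 = trans (*-cong refl y≈0) (zeroʳ _)

  pow-+ : ∀ x m n → pow x (m +ℕ n) ≈ pow x m * pow x n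
  pow-+ x zero    n = sym (*-identityˡ _)
  pow-+ x (suc m) n = trans (*-cong (pow-+ x m n) refl) (shuffle (pow x m) (pow x n) x)
    where
    shuffle : ∀ a b x → (a * b) * x ≈ (a * x) * b
    shuffle = solve 3 (λ a b x → (a :* b) :* x := (a :* x) :* b) refl

  pow-inverse : ∀ {x y} n → x * y ≈ 1# → pow x n * pow y n ≈ 1#
  pow-inverse zero    xy≈1 = *-identityˡ 1#
  pow-inverse {x} {y} (suc n) xy≈1 = begin
    (pow x n * x) * (pow y n * y) ≈⟨ interchange (pow x n) x (pow y n) y ⟩
    (pow x n * pow y n) * (x * y) ≈⟨ *-cong (pow-inverse n xy≈1) xy≈1 ⟩
    1# * 1#                       ≈⟨ *-identityˡ 1# ⟩
    1#                            ∎
    where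
    interchange : ∀ a b c d → (a * b) * (c * d) ≈ (a * c) * (b * d)
    interchange = solve 4 (λ a b c d → (a :* b) :* (c :* d) := (a :* c) :* (b :* d)) refl

  sgn-square : ∀ n → sgn n * sgn n ≈ 1#
  sgn-square n = pow-inverse n (trans (-1*x≈-x ring (- 1#)) (-‿involutive ring 1#))

  sumTo-cong : ∀ n {f g : ℕ → Carrier} → (∀ i → i < n → f i ≈ g i) → sumTo n f ≈ sumTo n g
  sumTo-cong zero    f≈g = refl
  sumTo-cong (suc n) f≈g = +-cong (sumTo-cong n (λ i i<n → f≈g i (ℕ.m<n⇒m<1+n i<n))) (f≈g n ℕ.≤-refl)

  sumTo-zero : ∀ n {f : ℕ → Carrier} → (∀ i → f i ≈ 0#) → sumTo n f ≈ 0#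
  sumTo-zero zero    f≈0 = refl
  sumTo-zero (suc n) f≈0 = trans (+-cong (sumTo-zero n f≈0) (f≈0 n)) (+-identityˡ 0#)

  *-distribˡ-sumTo : ∀ n x (f : ℕ → Carrier) → x * sumTo n f ≈ sumTo n (λ i → x * f i)
  *-distribˡ-sumTo zero    x f = zeroʳ x
  *-distribˡ-sumTo (suc n) x f = trans (distribˡ x _ _) (+-cong (*-distribˡ-sumTo n x f) refl)

  *-distribʳ-sumTo : ∀ n x (f : ℕ → Carrier) → sumTo n f * x ≈ sumTo n (λ i → f i * x)
  *-distribʳ-sumTo zero    x f = zeroˡ x
  *-distribʳ-sumTo (suc n) x f = trans (distribʳ x _ _) (+-cong (*-distribʳ-sumTo n x f) refl)

  sumTo-head-tail : ∀ n (f : ℕ → Carrier) → sumTo (suc n) f ≈ f 0 + sumTo n (λ i → f (suc i))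
  sumTo-head-tail zero    f = trans (+-identityˡ _) (sym (+-identityʳ _))
  sumTo-head-tail (suc n) f =
    trans (+-cong (sumTo-head-tail n f) refl) (+-assoc (f 0) (sumTo n (λ i → f (suc i))) (f (suc n)))

  sumTo-reverse : ∀ n (f : ℕ → Carrier) → sumTo n f ≈ sumTo n (λ i → f (n ∸ suc i))
  sumTo-reverse zero    f = refl
  sumTo-reverse (suc n) f = begin
    sumTo n f + f n                           ≈⟨ +-comm _ _ ⟩
    f n + sumTo n f                           ≈⟨ +-cong refl (sumTo-reverse n f) ⟩
    f n + sumTo n (λ i → f (n ∸ suc i))       ≈⟨ sumTo-head-tail n (λ i → f (n ∸ i)) ⟨
    sumTo (suc n) (λ i → f (n ∸ i))           ∎

  sumFin≈sumTo : ∀ n {f : Fin n → Carrier} {g : ℕ → Carrier} →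
                 (∀ i → f i ≈ g (toℕ i)) → sumFin n f ≈ sumTo n g
  sumFin≈sumTo zero    f≈g = refl
  sumFin≈sumTo (suc n) f≈g =
    trans (+-cong (f≈g fzero) (sumFin≈sumTo n (λ i → f≈g (fsuc i)))) (sym (sumTo-head-tail n _))

  -- ℕ-indexed, so that passing to a lower-right block is index arithmetic instead of Fin casts;
  -- detℕ n only reads the top-left n × n block.
  Matrix : Set c
  Matrix = ℕ → ℕ → Carrier

  punchInℕ : ℕ → ℕ → ℕ
  punchInℕ zero    j       = suc j
  punchInℕ (suc k) zero    = zero
  punchInℕ (suc k) (suc j) = suc (punchInℕ k j)

  toℕ-punchIn : ∀ {n} (k : Fin (suc n)) (j : Fin n) → toℕ (punchIn k j) ≡ punchInℕ (toℕ k) (toℕ j)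
  toℕ-punchIn fzero    j        = ≡.refl
  toℕ-punchIn (fsuc k) fzero    = ≡.refl
  toℕ-punchIn (fsuc k) (fsuc j) = ≡.cong suc (toℕ-punchIn k j)

  punchInℕ-< : ∀ {k j} → j < k → punchInℕ k j ≡ j
  punchInℕ-< {suc k} {zero}  _         = ≡.refl
  punchInℕ-< {suc k} {suc j} (s≤s j<k) = ≡.cong suc (punchInℕ-< j<k)

  punchInℕ-+ : ∀ k j → punchInℕ k (k +ℕ j) ≡ suc (k +ℕ j)
  punchInℕ-+ zero    j = ≡.refl
  punchInℕ-+ (suc k) j = ≡.cong suc (punchInℕ-+ k j)

  minor : Matrix → ℕ → Matrix
  minor M k i j = M (suc i) (punchInℕ k j)

  detℕ : ℕ → Matrix → Carrier
  detℕ zero    M = 1#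
  detℕ (suc n) M = sumTo (suc n) (λ k → sgn k * (M 0 k * detℕ n (minor M k)))

  det≈detℕ : ∀ n {M : Fin n → Fin n → Carrier} {N : Matrix} →
             (∀ i j → M i j ≈ N (toℕ i) (toℕ j)) → det n M ≈ detℕ n N
  det≈detℕ zero    M≈N = refl
  det≈detℕ (suc n) {N = N} M≈N = sumFin≈sumTo (suc n) λ k →
    *-cong refl (*-cong (M≈N fzero k) (det≈detℕ n λ i j →
      trans (M≈N (fsuc i) (punchIn k j)) (reflexive (≡.cong (N (suc (toℕ i))) (toℕ-punchIn k j)))))

  detℕ-cong : ∀ n {M N : Matrix} → (∀ i j → M i j ≈ N i j) → detℕ n M ≈ detℕ n N
  detℕ-cong zero    M≈N = refl
  detℕ-cong (suc n) M≈N = sumTo-cong (suc n) λ k _ →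
    *-cong refl (*-cong (M≈N 0 k) (detℕ-cong n (λ i j → M≈N (suc i) (punchInℕ k j))))

  detℕ-firstColumn : ∀ n M → (∀ i → M (suc i) 0 ≈ 0#) →
                     detℕ (suc n) M ≈ M 0 0 * detℕ n (λ i j → M (suc i) (suc j))
  detℕ-zeroColumn : ∀ n M → (∀ i → M i 0 ≈ 0#) → detℕ (suc n) M ≈ 0#
  otherMinors-vanish : ∀ n M → (∀ i → M (suc i) 0 ≈ 0#) →
                       sumTo n (λ k → sgn (suc k) * (M 0 (suc k) * detℕ n (minor M (suc k)))) ≈ 0#

  detℕ-firstColumn n M below≈0 = begin
    detℕ (suc n) M
      ≈⟨ sumTo-head-tail n _ ⟩
    1# * (M 0 0 * detℕ n (minor M 0)) + sumTo n (λ k → sgn (suc k) * (M 0 (suc k) * detℕ n (minor M (suc k))))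
      ≈⟨ +-cong (*-identityˡ _) (otherMinors-vanish n M below≈0) ⟩
    M 0 0 * detℕ n (minor M 0) + 0#
      ≈⟨ +-identityʳ _ ⟩
    M 0 0 * detℕ n (minor M 0) ∎

  detℕ-zeroColumn n M col≈0 = trans (detℕ-firstColumn n M (λ i → col≈0 (suc i))) (*-absorbsˡ (col≈0 0))

  otherMinors-vanish zero    M below≈0 = refl
  otherMinors-vanish (suc n) M below≈0 = sumTo-zero (suc n) λ k →
    *-absorbsʳ (*-absorbsʳ (detℕ-zeroColumn n (minor M (suc k)) below≈0))

  detℕ-blockLowerTriangular : ∀ k n M x →
    (∀ i j → j < k → j < i → M i j ≈ 0#) → (∀ i → i < k → M i i ≈ x) →
    detℕ (k +ℕ n) M ≈ pow x k * detℕ n (λ i j → M (k +ℕ i) (k +ℕ j))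
  detℕ-blockLowerTriangular zero    n M x _ _ = sym (*-identityˡ _)
  detℕ-blockLowerTriangular (suc k) n M x lower diagonal = begin
    detℕ (suc (k +ℕ n)) M
      ≈⟨ detℕ-firstColumn (k +ℕ n) M (λ i → lower (suc i) 0 (s≤s z≤n) (s≤s z≤n)) ⟩
    M 0 0 * detℕ (k +ℕ n) M′
      ≈⟨ *-cong (diagonal 0 (s≤s z≤n)) (detℕ-blockLowerTriangular k n M′ x
            (λ i j j<k j<i → lower (suc i) (suc j) (s≤s j<k) (s≤s j<i))
            (λ i i<k → diagonal (suc i) (s≤s i<k))) ⟩
    x * (pow x k * rest)
      ≈⟨ trans (sym (*-assoc _ _ _)) (*-cong (*-comm _ _) refl) ⟩
    (pow x k * x) * rest ∎
    where
    M′ : Matrix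
    M′ i j = M (suc i) (suc j)
    rest : Carrier
    rest = detℕ n (λ i j → M (suc k +ℕ i) (suc k +ℕ j))

  recurrence-shiftInvariant : (γ : ℕ → Carrier) (D : ℕ → ℕ → Carrier) →
    (∀ s → D s 0 ≈ D 0 0) →
    (∀ s m → D s (suc m) ≈ sumTo (suc m) (λ k → γ k * D (s +ℕ suc k) (m ∸ k))) →
    ∀ m s → D s m ≈ D 0 m
  recurrence-shiftInvariant γ D base step = <-rec (λ m → ∀ s → D s m ≈ D 0 m) invariant
    where
    invariant : ∀ m → (∀ {m′} → m′ < m → ∀ s → D s m′ ≈ D 0 m′) → ∀ s → D s m ≈ D 0 m
    invariant zero    _  s = base s
    invariant (suc m) ih s = trans (unshift s) (sym (unshift 0))
      where
      unshift : ∀ s → D s (suc m) ≈ sumTo (suc m) (λ k → γ k * D 0 (m ∸ k))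
      unshift s = trans (step s m) (sumTo-cong (suc m) λ k _ → *-cong refl (ih (s≤s (ℕ.m∸n≤m m k)) _))

  if≤ : ℕ → ℕ → Carrier → Carrier
  if≤ a b x with a ≤? b
  ... | yes _ = x
  ... | no  _ = 0#

  if≤-yes : ∀ {a b} x → a ≤ b → if≤ a b x ≈ x
  if≤-yes {a} {b} x a≤b with a ≤? b
  ... | yes _   = refl
  ... | no  a≰b = ⊥-elim (a≰b a≤b)

  if≤-no : ∀ {a b} x → ¬ a ≤ b → if≤ a b x ≈ 0#
  if≤-no {a} {b} x a≰b with a ≤? b
  ... | yes a≤b = ⊥-elim (a≰b a≤b)
  ... | no  _   = refl

  if≤-cong : ∀ {a b a′ b′ x x′} → (a ≤ b → a′ ≤ b′) → (a′ ≤ b′ → a ≤ b) → x ≈ x′ →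
             if≤ a b x ≈ if≤ a′ b′ x′
  if≤-cong {a} {b} {x′ = x′} to from x≈x′ with a ≤? b
  ... | yes a≤b = trans x≈x′ (sym (if≤-yes x′ (to a≤b)))
  ... | no  a≰b = sym (if≤-no x′ (λ a′≤b′ → a≰b (from a′≤b′)))

  module _ (q inv1q : Carrier) (fi : ℕ → Carrier)
           (qfact*fi≈1 : ∀ n → QNumbers.qfact q inv1q n * fi n ≈ 1#) (β : ℕ → Carrier) where
    open QNumbers q inv1q

    qbinom-diagonal : ∀ n → qbinom fi n n ≈ 1#
    qbinom-diagonal n = begin
      qfact n * (fi n * fi (n ∸ n)) ≈⟨ *-cong refl (*-cong refl (reflexive (≡.cong fi (ℕ.n∸n≡0 n)))) ⟩
      qfact n * (fi n * fi 0)       ≈⟨ *-cong refl (trans (*-cong refl fi0≈1) (*-identityʳ _)) ⟩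
      qfact n * fi n                ≈⟨ qfact*fi≈1 n ⟩
      1#                            ∎
      where
      fi0≈1 : fi 0 ≈ 1#
      fi0≈1 = trans (sym (*-identityˡ _)) (qfact*fi≈1 0)

    -- G 0 restricted to indices below j is H_j; G s shifts every q-binomial index by s.
    G : ℕ → Matrix
    G s i k = if≤ i (suc k) (qbinom fi (s +ℕ suc k) (s +ℕ i) * β (suc k ∸ i))

    H≈G : ∀ j (i k : Fin j) → H fi β j i k ≈ G 0 (toℕ i) (toℕ k)
    H≈G j i k with toℕ i ≤? suc (toℕ k)
    ... | yes _ = refl
    ... | no  _ = refl

    G-shift : ∀ s k i j → G s (k +ℕ i) (k +ℕ j) ≈ G (s +ℕ k) i j
    G-shift s k i j =
      if≤-cong to from (reflexive (≡.cong₂ _*_ (≡.cong₂ (qbinom fi) top bottom) (≡.cong β gap)))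
      where
      k+suc≡suc+ : k +ℕ suc j ≡ suc (k +ℕ j)
      k+suc≡suc+ = ℕ.+-suc k j
      to : k +ℕ i ≤ suc (k +ℕ j) → i ≤ suc j
      to le = ℕ.+-cancelˡ-≤ k i (suc j) (≡.subst (k +ℕ i ≤_) (≡.sym k+suc≡suc+) le)
      from : i ≤ suc j → k +ℕ i ≤ suc (k +ℕ j)
      from le = ≡.subst (k +ℕ i ≤_) k+suc≡suc+ (ℕ.+-monoʳ-≤ k le)
      top : s +ℕ suc (k +ℕ j) ≡ (s +ℕ k) +ℕ suc j
      top = ≡.trans (≡.cong (s +ℕ_) (≡.sym k+suc≡suc+)) (≡.sym (ℕ.+-assoc s k (suc j)))
      bottom : s +ℕ (k +ℕ i) ≡ (s +ℕ k) +ℕ i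
      bottom = ≡.sym (ℕ.+-assoc s k i)
      gap : suc (k +ℕ j) ∸ (k +ℕ i) ≡ suc j ∸ i
      gap = ≡.trans (≡.cong (_∸ (k +ℕ i)) (≡.sym k+suc≡suc+)) (ℕ.[m+n]∸[m+o]≡n∸o k (suc j) i)

    detG-minor : ∀ s m k → k ≤ m →
                 detℕ m (minor (G s) k) ≈ pow (β 0) k * detℕ (m ∸ k) (G (s +ℕ suc k))
    detG-minor s m k k≤m = begin
      detℕ m (minor (G s) k)
        ≡⟨ ≡.cong (λ n → detℕ n (minor (G s) k)) (≡.sym (ℕ.m+[n∸m]≡n k≤m)) ⟩
      detℕ (k +ℕ (m ∸ k)) (minor (G s) k)
        ≈⟨ detℕ-blockLowerTriangular k (m ∸ k) (minor (G s) k) (β 0) lower diagonal ⟩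
      pow (β 0) k * detℕ (m ∸ k) (λ i j → minor (G s) k (k +ℕ i) (k +ℕ j))
        ≈⟨ *-cong refl (detℕ-cong (m ∸ k) shifted) ⟩
      pow (β 0) k * detℕ (m ∸ k) (G (s +ℕ suc k)) ∎
      where
      lower : ∀ i j → j < k → j < i → minor (G s) k i j ≈ 0#
      lower i j j<k j<i rewrite punchInℕ-< j<k = if≤-no _ (ℕ.<⇒≱ (s≤s j<i))
      diagonal : ∀ i → i < k → minor (G s) k i i ≈ β 0
      diagonal i i<k rewrite punchInℕ-< i<k = begin
        if≤ (suc i) (suc i) (qbinom fi (s +ℕ suc i) (s +ℕ suc i) * β (i ∸ i))
          ≈⟨ if≤-yes {suc i} {suc i} _ ℕ.≤-refl ⟩
        qbinom fi (s +ℕ suc i) (s +ℕ suc i) * β (i ∸ i)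
          ≈⟨ *-unitˡ (qbinom-diagonal (s +ℕ suc i)) ⟩
        β (i ∸ i)
          ≡⟨ ≡.cong β (ℕ.n∸n≡0 i) ⟩
        β 0 ∎
      shifted : ∀ i j → minor (G s) k (k +ℕ i) (k +ℕ j) ≈ G (s +ℕ suc k) i j
      shifted i j rewrite punchInℕ-+ k j = G-shift s (suc k) i j

    firstRowTerm : ℕ → ℕ → ℕ → Carrier
    firstRowTerm s m k =
      sgn k * ((qbinom fi (s +ℕ suc k) s * β (suc k)) * (pow (β 0) k * detℕ (m ∸ k) (G (s +ℕ suc k))))

    detG-expansion : ∀ s m → detℕ (suc m) (G s) ≈ sumTo (suc m) (firstRowTerm s m)
    detG-expansion s m = sumTo-cong (suc m) λ k k<1+m →
      *-cong refl (*-cong firstRow (detG-minor s m k (ℕ.≤-pred k<1+m)))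
      where
      firstRow : ∀ {k} → G s 0 k ≈ qbinom fi (s +ℕ suc k) s * β (suc k)
      firstRow {k} = trans (if≤-yes {0} {suc k} _ z≤n)
                           (reflexive (≡.cong (λ t → qbinom fi (s +ℕ suc k) t * β (suc k)) (ℕ.+-identityʳ s)))

    Δ : ℕ → ℕ → Carrier
    Δ s m = detℕ m (G s) * (qfact s * fi (s +ℕ m))

    γ : ℕ → Carrier
    γ k = sgn k * ((β (suc k) * fi (suc k)) * pow (β 0) k)

    Δ-zero : ∀ s → Δ s 0 ≈ 1#
    Δ-zero s = trans (*-identityˡ _) (trans (*-cong refl (reflexive (≡.cong fi (ℕ.+-identityʳ s)))) (qfact*fi≈1 s))

    detG₀≈qfact*Δ₀ : ∀ m → detℕ m (G 0) ≈ qfact m * Δ 0 m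
    detG₀≈qfact*Δ₀ m = sym (begin
      qfact m * (detℕ m (G 0) * (1# * fi m)) ≈⟨ *-cong refl (*-cong refl (*-identityˡ _)) ⟩
      qfact m * (detℕ m (G 0) * fi m)        ≈⟨ shuffle _ _ _ ⟩
      (qfact m * fi m) * detℕ m (G 0)        ≈⟨ *-unitˡ (qfact*fi≈1 m) ⟩
      detℕ m (G 0)                           ∎)
      where
      shuffle : ∀ a d f → a * (d * f) ≈ (a * f) * d
      shuffle = solve 3 (λ a d f → a :* (d :* f) := (a :* f) :* d) refl

    Δ-recurrence : ∀ s m → Δ s (suc m) ≈ sumTo (suc m) (λ k → γ k * Δ (s +ℕ suc k) (m ∸ k))
    Δ-recurrence s m = begin
      detℕ (suc m) (G s) * scale
        ≈⟨ *-cong (detG-expansion s m) refl ⟩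
      sumTo (suc m) (firstRowTerm s m) * scale
        ≈⟨ *-distribʳ-sumTo (suc m) scale (firstRowTerm s m) ⟩
      sumTo (suc m) (λ k → firstRowTerm s m k * scale)
        ≈⟨ sumTo-cong (suc m) (λ k k<1+m → rescale k (ℕ.≤-pred k<1+m)) ⟩
      sumTo (suc m) (λ k → γ k * Δ (s +ℕ suc k) (m ∸ k)) ∎
      where
      scale : Carrier
      scale = qfact s * fi (s +ℕ suc m)
      rearrange : ∀ sg Q fs fk b P d qs F →
        (sg * (((Q * (fs * fk)) * b) * (P * d))) * (qs * F)
          ≈ (qs * fs) * ((sg * ((b * fk) * P)) * (d * (Q * F)))
      rearrange = solve 9 (λ sg Q fs fk b P d qs F →
        (sg :* (((Q :* (fs :* fk)) :* b) :* (P :* d))) :* (qs :* F)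
          := (qs :* fs) :* ((sg :* ((b :* fk) :* P)) :* (d :* (Q :* F)))) refl
      rescale : ∀ k → k ≤ m → firstRowTerm s m k * scale ≈ γ k * Δ (s +ℕ suc k) (m ∸ k)
      rescale k k≤m = begin
        firstRowTerm s m k * scale
          ≡⟨ ≡.cong₂ (λ a b → (sgn k * (((Q * (fi s * fi a)) * β (suc k)) * (pow (β 0) k * d))) * (qfact s * fi b))
                     (ℕ.m+n∸m≡n s (suc k)) split ⟩
        (sgn k * (((Q * (fi s * fi (suc k))) * β (suc k)) * (pow (β 0) k * d)))
          * (qfact s * fi ((s +ℕ suc k) +ℕ (m ∸ k)))
          ≈⟨ rearrange _ _ _ _ _ _ _ _ _ ⟩
        (qfact s * fi s) * (γ k * Δ (s +ℕ suc k) (m ∸ k))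
          ≈⟨ *-unitˡ (qfact*fi≈1 s) ⟩
        γ k * Δ (s +ℕ suc k) (m ∸ k) ∎
        where
        Q = qfact (s +ℕ suc k)
        d = detℕ (m ∸ k) (G (s +ℕ suc k))
        split : s +ℕ suc m ≡ (s +ℕ suc k) +ℕ (m ∸ k)
        split = ≡.trans (≡.cong (λ n → s +ℕ suc n) (≡.sym (ℕ.m+[n∸m]≡n k≤m)))
                        (≡.sym (ℕ.+-assoc s (suc k) (m ∸ k)))

    Δ₀-recurrence : ∀ m → Δ 0 (suc m) ≈ sumTo (suc m) (λ k → γ k * Δ 0 (m ∸ k))
    Δ₀-recurrence m =
      trans (Δ-recurrence 0 m) (sumTo-cong (suc m) λ k _ → *-cong refl (shiftInvariant (m ∸ k) (suc k)))
      where
      shiftInvariant : ∀ m s → Δ s m ≈ Δ 0 m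
      shiftInvariant = recurrence-shiftInvariant γ Δ (λ s → trans (Δ-zero s) (sym (Δ-zero 0))) Δ-recurrence

    module _ (b0i : Carrier) where
      α : ℕ → Carrier
      α = alpha fi β b0i

      α≈Δ : ∀ i → α i ≈ sgn i * (pow b0i (suc i) * (qfact i * Δ 0 i))
      α≈Δ zero    = sym (begin
        1# * ((1# * b0i) * (1# * Δ 0 0)) ≈⟨ *-identityˡ _ ⟩
        (1# * b0i) * (1# * Δ 0 0)        ≈⟨ *-cong (*-identityˡ _) (trans (*-identityˡ _) (Δ-zero 0)) ⟩
        b0i * 1#                         ≈⟨ *-identityʳ _ ⟩
        b0i                              ∎)
      α≈Δ (suc j) = *-cong refl (*-cong refl
        (trans (det≈detℕ (suc j) {N = G 0} (H≈G (suc j))) (detG₀≈qfact*Δ₀ (suc j))))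

      scaleΔ : ℕ → Carrier
      scaleΔ m = sgn (suc m) * (pow b0i (suc (suc m)) * qfact (suc m))

      -- The factors (-1)^{2t} and (b0i β₀)^t cancel, and [i]! fi i = 1 is inserted to rebuild α i.
      convolutionTerm : β 0 * b0i ≈ 1# → ∀ i t →
        scaleΔ (i +ℕ t) * (γ t * Δ 0 i)
          ≈ - 1# * (b0i * (qbinom fi (suc (i +ℕ t)) i * (β (suc (i +ℕ t) ∸ i) * α i)))
      convolutionTerm β₀*b0i≈1 i t = begin
        scaleΔ (i +ℕ t) * (γ t * Δ 0 i)
          ≈⟨ *-cong (*-cong (*-cong (pow-+ (- 1#) i t) refl)
                            (*-cong (*-cong (*-cong (pow-+ b0i i t) refl) refl) refl)) refl ⟩
        (((sgn i * sgn t) * - 1#) * ((((pow b0i i * pow b0i t) * b0i) * b0i) * Q))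
          * ((sgn t * ((B * F) * pow (β 0) t)) * D)
          ≈⟨ gather _ _ _ _ _ _ _ _ _ _ _ ⟩
        (sgn t * sgn t) * ((pow b0i t * pow (β 0) t) * W)
          ≈⟨ *-unitˡ (sgn-square t) ⟩
        (pow b0i t * pow (β 0) t) * W
          ≈⟨ *-unitˡ (pow-inverse t (trans (*-comm b0i (β 0)) β₀*b0i≈1)) ⟩
        W
          ≈⟨ *-unitˡ (qfact*fi≈1 i) ⟨
        (qfact i * fi i) * W
          ≈⟨ scatter _ _ _ _ _ _ _ _ _ _ ⟩
        - 1# * (b0i * ((Q * (fi i * F)) * (B * (sgn i * ((pow b0i i * b0i) * (qfact i * D))))))
          ≈⟨ *-cong refl (*-cong refl (*-cong refl (*-cong refl (α≈Δ i)))) ⟨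
        - 1# * (b0i * ((Q * (fi i * fi (suc t))) * (β (suc t) * α i)))
          ≡⟨ ≡.cong (λ n → - 1# * (b0i * ((Q * (fi i * fi n)) * (β n * α i)))) (≡.sym gap) ⟩
        - 1# * (b0i * (qbinom fi (suc (i +ℕ t)) i * (β (suc (i +ℕ t) ∸ i) * α i))) ∎
        where
        Q = qfact (suc (i +ℕ t))
        B = β (suc t)
        F = fi (suc t)
        D = Δ 0 i
        W = - 1# * (sgn i * (pow b0i i * (b0i * (b0i * (Q * (B * (F * D)))))))
        gap : suc (i +ℕ t) ∸ i ≡ suc t
        gap = ≡.trans (≡.cong (_∸ i) (≡.sym (ℕ.+-suc i t))) (ℕ.m+n∸m≡n i (suc t))
        gather : ∀ si st e pi pt b Q B F pβ D →
          (((si * st) * e) * ((((pi * pt) * b) * b) * Q)) * ((st * ((B * F) * pβ)) * D)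
            ≈ (st * st) * ((pt * pβ) * (e * (si * (pi * (b * (b * (Q * (B * (F * D)))))))))
        gather = solve 11 (λ si st e pi pt b Q B F pβ D →
          (((si :* st) :* e) :* ((((pi :* pt) :* b) :* b) :* Q)) :* ((st :* ((B :* F) :* pβ)) :* D)
            := (st :* st) :* ((pt :* pβ) :* (e :* (si :* (pi :* (b :* (b :* (Q :* (B :* (F :* D)))))))))) refl
        scatter : ∀ si e pi b Q B F D fii qfi →
          (qfi * fii) * (e * (si * (pi * (b * (b * (Q * (B * (F * D))))))))
            ≈ e * (b * ((Q * (fii * F)) * (B * (si * ((pi * b) * (qfi * D))))))
        scatter = solve 10 (λ si e pi b Q B F D fii qfi →
          (qfi :* fii) :* (e :* (si :* (pi :* (b :* (b :* (Q :* (B :* (F :* D))))))))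
            := e :* (b :* ((Q :* (fii :* F)) :* (B :* (si :* ((pi :* b) :* (qfi :* D))))))) refl

      α-recurrence : β 0 * b0i ≈ 1# → ∀ m →
        α (suc m) ≈ - (b0i * sumTo (suc m) (λ i → qbinom fi (suc m) i * (β (suc m ∸ i) * α i)))
      α-recurrence β₀*b0i≈1 m = begin
        α (suc m)
          ≈⟨ α≈Δ (suc m) ⟩
        sgn (suc m) * (pow b0i (suc (suc m)) * (qfact (suc m) * Δ 0 (suc m)))
          ≈⟨ reassociate _ _ _ _ ⟩
        scaleΔ m * Δ 0 (suc m)
          ≈⟨ *-cong refl (Δ₀-recurrence m) ⟩
        scaleΔ m * sumTo (suc m) (λ k → γ k * Δ 0 (m ∸ k))
          ≈⟨ *-distribˡ-sumTo (suc m) (scaleΔ m) _ ⟩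
        sumTo (suc m) (λ k → scaleΔ m * (γ k * Δ 0 (m ∸ k)))
          ≈⟨ sumTo-reverse (suc m) _ ⟩
        sumTo (suc m) (λ i → scaleΔ m * (γ (m ∸ i) * Δ 0 (m ∸ (m ∸ i))))
          ≈⟨ sumTo-cong (suc m) (λ i i<1+m → reindexed i (ℕ.≤-pred i<1+m)) ⟩
        sumTo (suc m) (λ i → - 1# * (b0i * T i))
          ≈⟨ *-distribˡ-sumTo (suc m) (- 1#) _ ⟨
        - 1# * sumTo (suc m) (λ i → b0i * T i)
          ≈⟨ *-cong refl (*-distribˡ-sumTo (suc m) b0i T) ⟨
        - 1# * (b0i * sumTo (suc m) T)
          ≈⟨ -1*x≈-x ring _ ⟩
        - (b0i * sumTo (suc m) T) ∎
        where
        T : ℕ → Carrier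
        T i = qbinom fi (suc m) i * (β (suc m ∸ i) * α i)
        reassociate : ∀ a b c d → a * (b * (c * d)) ≈ (a * (b * c)) * d
        reassociate = solve 4 (λ a b c d → a :* (b :* (c :* d)) := (a :* (b :* c)) :* d) refl
        reindexed : ∀ i → i ≤ m → scaleΔ m * (γ (m ∸ i) * Δ 0 (m ∸ (m ∸ i))) ≈ - 1# * (b0i * T i)
        reindexed i i≤m with ℕ.m≤n⇒∃[o]m+o≡n i≤m
        ... | t , ≡.refl rewrite ℕ.m+n∸m≡n i t | ℕ.m+n∸n≡m i t = convolutionTerm β₀*b0i≈1 i t

mainTheorem4 : {c ℓ : Level} (R : CommutativeRing c ℓ) →
    let open CommutativeRing R
        open QDefs R
    in (q inv1q : Carrier) → (1# - q) * inv1q ≈ 1# →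
       (fi : ℕ → Carrier) → (∀ n → QNumbers.qfact q inv1q n * fi n ≈ 1#) →
       (β : ℕ → Carrier) (b0i : Carrier) → β 0 * b0i ≈ 1# →
       (j : ℕ) → 1 ≤ j →
       QNumbers.alpha q inv1q fi β b0i j
         ≈ - (b0i * sumTo j (λ i → QNumbers.qbinom q inv1q fi j i * (β (j ∸ i) * QNumbers.alpha q inv1q fi β b0i i)))
mainTheorem4 R q inv1q _ fi qfact*fi≈1 β b0i β₀*b0i≈1 (suc m) _ =
  α-recurrence R q inv1q fi qfact*fi≈1 β b0i β₀*b0i≈1 m
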